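{- Let $d, n$ be positive integers with $d \geq 2$ and $n \geq d$. Let $R = (r_{1}, \dots, r_{n}) \in \mathbf{R}^{n}$ with $r_{1} \geq \cdots \geq r_{n} \geq 0$. Assume that $\mathcal{N}_{0}(d; R)$ is a nonempty compact convex polytope. If $A \in \mathcal{N}_{0}(d; R)$ is an extreme point of $\mathcal{N}_{0}(d; R)$, then $A$ has at most $n \cdot d!$ positive entries.
   Context: Write $\langle n \rangle = \{1, \dots, n\}$. A real $d$-hypermatrix of size $n$ is a function $A: \langle n \rangle^{d} \to \mathbf{R}$; its values are its entries. $A$ is nonnegative if all entries are $\geq 0$; symmetric if $A(i_{\pi(1)}, \dots, i_{\pi(d)}) = A(i_{1}, \dots, i_{d})$ for all indices and all permutations $\pi$ of $\{1,\dots,d\}$; strongly off-diagonal if every entry $A(i_1,\dots,i_d)$ with $i_k = i_l$ for some $k \neq l$ equals $0$. $\mathcal{N}_{0}(d; R)$ denotes the set of strongly off-diagonal symmetric nonnegative $d$-hypermatrices of size $n$ such that $\sum_{i_2,\dots,i_d \in \langle n\rangle} A(j,i_2,\dots,i_d) = r_j$ for each $j \in \langle n \rangle$. An extreme point of a convex set $C$ is a point of $C$ that is not an interior point of any line segment contained in $C$. -}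

module Defs where

open import Data.Nat as ℕ using (ℕ; zero; suc)
open import Data.Fin as Fin using (Fin)
open import Data.Fin.Permutation using (Permutation′; _⟨$⟩ʳ_)
open import Data.Vec.Functional using (_∷_)
open import Data.List using (List; length)
open import Data.List.Relation.Unary.All using (All)
open import Data.List.Relation.Unary.AllPairs using (AllPairs)
open import Data.Product using (Σ; ∃; _×_; _,_)
open import Data.Sum using (_⊎_)
open import Data.Empty using (⊥)
open import Relation.Nullary using (¬_)
open import Relation.Binary.PropositionalEquality using (_≡_; _≢_)
open import Function using (_∘_)

-- The real numbers, axiomatised as a Dedekind-complete ordered field
-- (this characterises ℝ up to isomorphism).  The stdlib has no reals.

record RealField : Set₁ where
  infixl 6 _+_
  infixl 7 _*_
  infix 4 _<_ _≤_
  field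
    Carrier : Set
    0# 1#   : Carrier
    _+_ _*_ : Carrier → Carrier → Carrier
    -_      : Carrier → Carrier
    _<_     : Carrier → Carrier → Set
    +-assoc  : ∀ x y z → (x + y) + z ≡ x + (y + z)
    +-comm   : ∀ x y → x + y ≡ y + x
    +-identˡ : ∀ x → 0# + x ≡ x
    +-invˡ   : ∀ x → (- x) + x ≡ 0#
    *-assoc  : ∀ x y z → (x * y) * z ≡ x * (y * z)
    *-comm   : ∀ x y → x * y ≡ y * x
    *-identˡ : ∀ x → 1# * x ≡ x
    distribˡ : ∀ x y z → x * (y + z) ≡ x * y + x * z
    0≢1      : 0# ≢ 1#
    *-inv    : ∀ x → x ≢ 0# → Σ Carrier λ y → y * x ≡ 1#
    <-irrefl : ∀ x → ¬ (x < x)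
    <-trans  : ∀ {x y z} → x < y → y < z → x < z
    <-tri    : ∀ x y → x < y ⊎ (x ≡ y ⊎ y < x)
    +-mono-< : ∀ {x y} z → x < y → x + z < y + z
    *-pos    : ∀ {x y} → 0# < x → 0# < y → 0# < x * y
    sup : (P : Carrier → Set) → (∃ λ x → P x) →
          (∃ λ b → ∀ x → P x → x < b ⊎ x ≡ b) →
          ∃ λ s → (∀ x → P x → x < s ⊎ x ≡ s) ×
                  (∀ b → (∀ x → P x → x < b ⊎ x ≡ b) → s < b ⊎ s ≡ b)

  _≤_ : Carrier → Carrier → Set
  x ≤ y = x < y ⊎ x ≡ y

  _-_ : Carrier → Carrier → Carrier
  x - y = x + (- y)

module Hypermatrices (ℝ : RealField) where
  open RealField ℝ renaming (Carrier to R)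

  sumFin : (n : ℕ) → (Fin n → R) → R
  sumFin zero    f = 0#
  sumFin (suc n) f = f Fin.zero + sumFin n (f ∘ Fin.suc)

  Index : ℕ → ℕ → Set
  Index d n = Fin d → Fin n

  sumIdx : (m n : ℕ) → (Index m n → R) → R
  sumIdx zero    n f = f (λ ())
  sumIdx (suc m) n f = sumFin n λ x → sumIdx m n λ rest → f (x ∷ rest)

  Hypermatrix : ℕ → ℕ → Set
  Hypermatrix d n = Index d n → R

  Nonnegative : ∀ {d n} → Hypermatrix d n → Set
  Nonnegative A = ∀ i → 0# ≤ A i

  Symmetric : ∀ {d n} → Hypermatrix d n → Set
  Symmetric {d} A = ∀ i (π : Permutation′ d) → A (λ k → i (π ⟨$⟩ʳ k)) ≡ A i

  StronglyOffDiagonal : ∀ {d n} → Hypermatrix d n → Set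
  StronglyOffDiagonal {d} A = ∀ i (k l : Fin d) → k ≢ l → i k ≡ i l → A i ≡ 0#

  rowSum : ∀ {d n} → Hypermatrix d n → Fin n → R
  rowSum {zero}  {n} A j = 0#   -- not used (d ≥ 2)
  rowSum {suc e} {n} A j = sumIdx e n λ rest → A (j ∷ rest)

  InN₀ : ∀ d n → (Fin n → R) → Hypermatrix d n → Set
  InN₀ d n r A = StronglyOffDiagonal A × Symmetric A × Nonnegative A ×
                 (∀ j → rowSum A j ≡ r j)

  _≐_ : ∀ {d n} → Hypermatrix d n → Hypermatrix d n → Set
  A ≐ B = ∀ i → A i ≡ B i

  comb : ∀ {d n} → R → Hypermatrix d n → Hypermatrix d n → Hypermatrix d n
  comb s B C i = s * B i + (1# - s) * C i

  IsExtremePoint : ∀ {d n} → (Hypermatrix d n → Set) → Hypermatrix d n → Set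
  IsExtremePoint {d} {n} S A =
    S A ×
    (∀ (B C : Hypermatrix d n) →
       (∀ s → 0# ≤ s → s ≤ 1# → S (comb s B C)) →
       ¬ (B ≐ C) →
       ¬ (∃ λ t → 0# < t × t < 1# × A ≐ comb t B C))

  convComb : ∀ {d n} (m : ℕ) → (Fin m → R) → (Fin m → Hypermatrix d n) →
             Hypermatrix d n
  convComb m w P i = sumFin m λ k → w k * P k i

  IsPolytope : ∀ {d n} → (Hypermatrix d n → Set) → Set
  IsPolytope {d} {n} S =
    ∃ λ (m : ℕ) → ∃ λ (P : Fin m → Hypermatrix d n) →
      ∀ A → (S A → ∃ λ w → (∀ k → 0# ≤ w k) × sumFin m w ≡ 1# × A ≐ convComb m w P)
          × (∀ w → (∀ k → 0# ≤ w k) → sumFin m w ≡ 1# → ∀ A → A ≐ convComb m w P → S A)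

  AtMostPositiveEntries : ∀ {d n} → ℕ → Hypermatrix d n → Set
  AtMostPositiveEntries {d} {n} N A =
    ∀ (xs : List (Index d n)) →
      AllPairs (λ i j → ¬ (∀ k → i k ≡ j k)) xs →
      All (λ i → 0# < A i) xs →
      length xs ℕ.≤ N

{-# OPTIONS --safe #-}
module Submission where

-- Every index tuple at which A is positive has distinct entries (A is strongly off-diagonal), so
-- the positive entries fall into classes according to the set of their entries, and at most d!
-- tuples share a given entry set.  It therefore suffices that the positive entries of an extreme
-- point A meet at most n classes.  If they met m > n classes, the homogeneous n × m system
-- ∑ₖ yₖ · (row sum j of A restricted to class k) = 0 would have a solution y ≠ 0.  Multiplying A
-- on class k by 1 ± 2εyₖ, with ε = 1/(1 + ∑ yₖ²) so that both factors are nonnegative, gives two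
-- distinct points of 𝒩₀(d; R) whose midpoint is A.

open import Defs

module Counting where

  open import Data.Nat as ℕ using (ℕ; zero; suc; _≤_; _*_; _!; z≤n; s≤s)
  import Data.Nat.Properties as ℕ
  open import Data.Nat.ListAction using (sum)
  open import Data.Fin as Fin using (Fin)
  import Data.Fin.Properties as Fin
  open import Data.Fin.Subset using (Subset)
  open import Data.Fin.Permutation using (Permutation′; _⟨$⟩ʳ_; _⟨$⟩ˡ_; inverseʳ)
  import Data.Bool.Properties as Bool
  import Data.Vec as Vec
  import Data.Vec.Properties as Vec
  open import Data.List as List using (List; []; _∷_; length; filter; map; deduplicate)
  import Data.List.Properties as List
  open import Data.List.Membership.Propositional using (_∈_)
  open import Data.List.Membership.Propositional.Properties
    using (∈-filter⁺; ∈-map⁺; ∈-map⁻; ∈-deduplicate⁺; ∈-deduplicate⁻; ∈-lookup)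
  open import Data.List.Relation.Unary.Unique.Propositional using (Unique)
  open import Data.List.Relation.Unary.All as All using (All; []; _∷_)
  import Data.List.Relation.Unary.All.Properties as All
  open import Data.List.Relation.Unary.Any as Any using (here; there)
  import Data.List.Relation.Unary.Any.Properties as Any
  open import Data.List.Relation.Unary.AllPairs using (AllPairs; []; _∷_)
  import Data.List.Relation.Unary.AllPairs.Properties as AllPairs
  open import Data.Product using (∃; _×_; _,_)
  open import Data.Empty using (⊥-elim)
  open import Function using (_∘_; mk⇔)
  open import Function.Definitions using (Injective)
  open import Relation.Nullary using (¬_; Dec; yes; no; does; proof; ¬?)
  open import Relation.Nullary.Decidable using (does-⇔; dec-true)
  open import Relation.Nullary.Reflects using (Reflects; invert)
  open import Data.Bool using (true)
  open import Relation.Binary.Definitions using (DecidableEquality)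
  open import Relation.Binary.PropositionalEquality

  module _ {A K : Set} (_≟_ : DecidableEquality K) (key : A → K) where

    fibre : K → List A → List A
    fibre k = filter (λ x → key x ≟ k)

    private
      fibreSizes : List K → List A → ℕ
      fibreSizes ks xs = sum (map (λ k → length (fibre k xs)) ks)

      length-fibre-∷ : ∀ k x xs → length (fibre k xs) ≤ length (fibre k (x ∷ xs))
      length-fibre-∷ k x xs with key x ≟ k
      ... | yes _ = ℕ.n≤1+n _
      ... | no _  = ℕ.≤-refl

      fibreSizes-∷ : ∀ x xs ks → fibreSizes ks xs ≤ fibreSizes ks (x ∷ xs)
      fibreSizes-∷ x xs []       = z≤n
      fibreSizes-∷ x xs (k ∷ ks) = ℕ.+-mono-≤ (length-fibre-∷ k x xs) (fibreSizes-∷ x xs ks)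

      fibreSizes-∷-∈ : ∀ x xs {ks} → key x ∈ ks → fibreSizes ks xs ℕ.< fibreSizes ks (x ∷ xs)
      fibreSizes-∷-∈ x xs {k ∷ ks} (here refl)
        rewrite List.filter-accept (λ y → key y ≟ key x) {x} {xs} refl =
        s≤s (ℕ.+-monoʳ-≤ (length (fibre k xs)) (fibreSizes-∷ x xs ks))
      fibreSizes-∷-∈ x xs {k ∷ ks} (there x∈ks) =
        ℕ.≤-trans (ℕ.≤-reflexive (sym (ℕ.+-suc _ _)))
                  (ℕ.+-mono-≤ (length-fibre-∷ k x xs) (fibreSizes-∷-∈ x xs x∈ks))

      length≤fibreSizes : ∀ ks xs → All (λ x → key x ∈ ks) xs → length xs ≤ fibreSizes ks xs
      length≤fibreSizes ks []       []             = z≤n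
      length≤fibreSizes ks (x ∷ xs) (x∈ks ∷ xs∈ks) =
        ℕ.≤-trans (s≤s (length≤fibreSizes ks xs xs∈ks)) (fibreSizes-∷-∈ x xs x∈ks)

      sum-bound : ∀ c ks (f : K → ℕ) → (∀ {k} → k ∈ ks → f k ≤ c) → sum (map f ks) ≤ length ks * c
      sum-bound c []       f f≤c = z≤n
      sum-bound c (k ∷ ks) f f≤c = ℕ.+-mono-≤ (f≤c (here refl)) (sum-bound c ks f (f≤c ∘ there))

    length≤fibre-bound : ∀ c ks xs → All (λ x → key x ∈ ks) xs →
                         (∀ {k} → k ∈ ks → length (fibre k xs) ≤ c) → length xs ≤ length ks * c
    length≤fibre-bound c ks xs keys∈ks bound =
      ℕ.≤-trans (length≤fibreSizes ks xs keys∈ks) (sum-bound c ks _ bound)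

  allPairs-weaken : ∀ {A : Set} {P : A → Set} {R S : A → A → Set} {xs} →
                    (∀ {a b} → P a → P b → R a b → S a b) → All P xs → AllPairs R xs → AllPairs S xs
  allPairs-weaken R⇒S []         []          = []
  allPairs-weaken R⇒S (pa ∷ pxs) (Rs ∷ Rxs) =
    All.zipWith (λ (pb , r) → R⇒S pa pb r) (pxs , Rs) ∷ allPairs-weaken R⇒S pxs Rxs

  Apart : ∀ {d n} → (Fin d → Fin n) → (Fin d → Fin n) → Set
  Apart s t = ¬ (∀ k → s k ≡ t k)

  InjectiveInto : ∀ {d n} → List (Fin n) → (Fin d → Fin n) → Set
  InjectiveInto S t = Injective _≡_ _≡_ t × (∀ k → t k ∈ S)

  -- Splitting by the first value x ∈ S, the tails are injections into S ∖ {x}.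
  length-apart-injections : ∀ {n} d (S : List (Fin n)) → length S ≤ d → (ts : List (Fin d → Fin n)) →
                            AllPairs Apart ts → All (InjectiveInto S) ts → length ts ≤ d !
  length-apart-injections zero    S _ []            _                   _ = z≤n
  length-apart-injections zero    S _ (_ ∷ [])      _                   _ = s≤s z≤n
  length-apart-injections zero    S _ (_ ∷ _ ∷ _)   ((s≉t ∷ _) ∷ _)     _ = ⊥-elim (s≉t (λ ()))
  length-apart-injections {n} (suc d) S |S|≤1+d ts apart injections =
    ℕ.≤-trans (length≤fibre-bound Fin._≟_ head (d !) S ts heads∈S fibre≤d!)
              (ℕ.*-monoˡ-≤ (d !) |S|≤1+d)
    where
    head : (Fin (suc d) → Fin n) → Fin n
    head t = t Fin.zero
    tail : (Fin (suc d) → Fin n) → Fin d → Fin n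
    tail t = t ∘ Fin.suc
    heads∈S : All (λ t → head t ∈ S) ts
    heads∈S = All.map (λ (_ , t∈S) → t∈S Fin.zero) injections
    fibre≤d! : ∀ {x} → x ∈ S → length (fibre Fin._≟_ head x ts) ≤ d !
    fibre≤d! {x} x∈S = subst (_≤ d !) (List.length-map tail tsₓ)
      (length-apart-injections d S′ |S′|≤d (map tail tsₓ)
        (AllPairs.map⁺ (allPairs-weaken tails-apart heads≡x (AllPairs.filter⁺ _ apart)))
        (All.map⁺ (All.zipWith tail-injective (All.filter⁺ _ injections , heads≡x))))
      where
      tsₓ : List (Fin (suc d) → Fin n)
      tsₓ = fibre Fin._≟_ head x ts
      S′ : List (Fin n)
      S′ = filter (λ y → ¬? (y Fin.≟ x)) S
      heads≡x : All (λ t → head t ≡ x) tsₓ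
      heads≡x = All.all-filter _ ts
      tails-apart : ∀ {s t} → head s ≡ x → head t ≡ x → Apart s t → Apart (tail s) (tail t)
      tails-apart s₀≡x t₀≡x s≉t tails≡ = s≉t λ
        { Fin.zero    → trans s₀≡x (sym t₀≡x)
        ; (Fin.suc k) → tails≡ k }
      tail-injective : ∀ {t} → InjectiveInto S t × head t ≡ x → InjectiveInto S′ (tail t)
      tail-injective ((inj , t∈S) , t₀≡x) =
        Fin.suc-injective ∘ inj ,
        λ k → ∈-filter⁺ _ (t∈S (Fin.suc k)) (λ tₖ≡x → Fin.0≢1+n (inj (trans t₀≡x (sym tₖ≡x))))
      |S′|≤d : length S′ ≤ d
      |S′|≤d = ℕ.≤-pred (ℕ.≤-trans (List.filter-notAll _ S (Any.map (λ y≡x y≢x → y≢x (sym y≡x)) x∈S))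
                                   |S|≤1+d)

  image : ∀ {d n} → (Fin d → Fin n) → Subset n
  image t = Vec.tabulate (λ y → does (Fin.any? (λ k → t k Fin.≟ y)))

  image-permute : ∀ {d n} (t : Fin d → Fin n) (π : Permutation′ d) →
                  image (λ k → t (π ⟨$⟩ʳ k)) ≡ image t
  image-permute t π = Vec.tabulate-cong λ y → does-⇔
    (mk⇔ (λ (k , tπk≡y) → π ⟨$⟩ʳ k , tπk≡y)
         (λ (k , tk≡y) → π ⟨$⟩ˡ k , trans (cong t (inverseʳ π)) tk≡y))
    (Fin.any? _) (Fin.any? _)

  lookup-image : ∀ {d n} (t : Fin d → Fin n) y →
                 Vec.lookup (image t) y ≡ does (Fin.any? (λ k → t k Fin.≟ y))
  lookup-image t y = Vec.lookup∘tabulate _ y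

  image-values : ∀ {d n} (s t : Fin d → Fin n) → image s ≡ image t → ∀ k → s k ∈ List.tabulate t
  image-values s t image-s≡image-t k = let k′ , tk′≡sk = t-hits-sk in Any.tabulate⁺ k′ (sym tk′≡sk)
    where
    open ≡-Reasoning
    t-hits-sk? : Dec (∃ λ k′ → t k′ ≡ s k)
    t-hits-sk? = Fin.any? (λ k′ → t k′ Fin.≟ s k)
    t-hits-sk : ∃ λ k′ → t k′ ≡ s k
    t-hits-sk = invert (subst (Reflects _) (begin
      does t-hits-sk?                            ≡⟨ sym (lookup-image t (s k)) ⟩
      Vec.lookup (image t) (s k)                 ≡⟨ cong (λ v → Vec.lookup v (s k)) (sym image-s≡image-t) ⟩
      Vec.lookup (image s) (s k)                 ≡⟨ lookup-image s (s k) ⟩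
      does (Fin.any? (λ k′ → s k′ Fin.≟ s k))   ≡⟨ dec-true (Fin.any? _) (k , refl) ⟩
      true                                       ∎) (proof t-hits-sk?))

  _≟ₛ_ : ∀ {n} → DecidableEquality (Subset n)
  _≟ₛ_ = Vec.≡-dec Bool._≟_

  distinctImages : ∀ {d n} → List (Fin d → Fin n) → List (Subset n)
  distinctImages ts = deduplicate _≟ₛ_ (map image ts)

  ∈-distinctImages⁻ : ∀ {d n} {S : Subset n} (ts : List (Fin d → Fin n)) →
                      S ∈ distinctImages ts → ∃ λ t → t ∈ ts × image t ≡ S
  ∈-distinctImages⁻ ts S∈
    with t , t∈ts , refl ← ∈-map⁻ image (∈-deduplicate⁻ _≟ₛ_ (map image ts) S∈) = t , t∈ts , refl

  lookup-injective : ∀ {A : Set} {xs : List A} → Unique xs → Injective _≡_ _≡_ (List.lookup xs)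
  lookup-injective (_    ∷ _)   {Fin.zero}  {Fin.zero}  _     = refl
  lookup-injective (x∉xs ∷ _)   {Fin.zero}  {Fin.suc j} x≡xⱼ  = ⊥-elim (All.lookup x∉xs (∈-lookup j) x≡xⱼ)
  lookup-injective (x∉xs ∷ _)   {Fin.suc i} {Fin.zero}  xᵢ≡x  =
    ⊥-elim (All.lookup x∉xs (∈-lookup i) (sym xᵢ≡x))
  lookup-injective (_    ∷ xs!) {Fin.suc i} {Fin.suc j} xᵢ≡xⱼ = cong Fin.suc (lookup-injective xs! xᵢ≡xⱼ)

  distinctImages-unique : ∀ {d n} (ts : List (Fin d → Fin n)) → Unique (distinctImages ts)
  distinctImages-unique ts = deduplicate-! (map image ts)
    where
    open import Data.List.Relation.Unary.Unique.DecPropositional.Properties _≟ₛ_ using (deduplicate-!)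

  length≤distinctImages*! : ∀ {d n} (ts : List (Fin d → Fin n)) → AllPairs Apart ts →
                            All (Injective _≡_ _≡_) ts → length ts ≤ length (distinctImages ts) * d !
  length≤distinctImages*! {d} ts apart injective =
    length≤fibre-bound _≟ₛ_ image (d !) (distinctImages ts) ts
      (All.tabulate (∈-deduplicate⁺ _≟ₛ_ ∘ ∈-map⁺ image))
      fibre≤d!
    where
    fibre≤d! : ∀ {S} → S ∈ distinctImages ts → length (fibre _≟ₛ_ image S ts) ≤ d !
    fibre≤d! S∈ with r , _ , refl ← ∈-distinctImages⁻ ts S∈ =
      length-apart-injections d (List.tabulate r) (ℕ.≤-reflexive (List.length-tabulate r)) _
        (AllPairs.filter⁺ _ apart)
        (All.zipWith (λ (inj , image-t≡image-r) → inj , image-values _ r image-t≡image-r)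
          (All.filter⁺ _ injective , All.all-filter _ ts))

module OrderedField (ℝ : RealField) where

  open import Algebra.Bundles using (CommutativeRing)
  open import Algebra.Structures using (IsCommutativeRing)
  import Algebra.Solver.Ring.AlmostCommutativeRing as ACR
  open import Data.Integer as ℤ using (ℤ; -[1+_]; _⊖_; 1ℤ)
  import Data.Integer.Properties as ℤ
  open import Data.Nat as ℕ using (ℕ; zero; suc)
  import Data.Nat.Properties as ℕ
  open import Data.Sign as Sign using (Sign)
  open import Data.Maybe using (Maybe; just; nothing)
  open import Data.Product using (_×_; _,_)
  open import Data.Sum using (inj₁; inj₂)
  open import Data.Empty using (⊥-elim)
  open import Relation.Nullary using (Dec; yes; no)
  open import Relation.Binary.PropositionalEquality

  -- RealField._-_ has no fixity declaration, so it binds tighter than _+_ and _*_: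
  -- x - y * z parses as (x - y) * z.  Subtractions are therefore parenthesised throughout.
  open RealField ℝ renaming (Carrier to R)

  +-identityʳ : ∀ x → x + 0# ≡ x
  +-identityʳ x = trans (+-comm x 0#) (+-identˡ x)

  *-identityʳ : ∀ x → x * 1# ≡ x
  *-identityʳ x = trans (*-comm x 1#) (*-identˡ x)

  isCommutativeRing : IsCommutativeRing _≡_ _+_ _*_ -_ 0# 1#
  isCommutativeRing = record
    { isRing = record
      { +-isAbelianGroup = record
        { isGroup = record
          { isMonoid = record
            { isSemigroup = record
              { isMagma = record { isEquivalence = isEquivalence ; ∙-cong = cong₂ _+_ }
              ; assoc = +-assoc }
            ; identity = +-identˡ , +-identityʳ }
          ; inverse = +-invˡ , λ x → trans (+-comm x (- x)) (+-invˡ x)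
          ; ⁻¹-cong = cong (λ x → - x) }
        ; comm = +-comm }
      ; *-cong = cong₂ _*_
      ; *-assoc = *-assoc
      ; *-identity = *-identˡ , *-identityʳ
      ; distrib = distribˡ , λ x y z → trans (*-comm (y + z) x)
                    (trans (distribˡ x y z) (cong₂ _+_ (*-comm x y) (*-comm x z))) }
    ; *-comm = *-comm }

  commutativeRing : CommutativeRing _ _
  commutativeRing = record { isCommutativeRing = isCommutativeRing }

  open CommutativeRing commutativeRing public using (-‿inverseʳ; zeroˡ; zeroʳ; semiring)
  open CommutativeRing commutativeRing using (+-group; +-abelianGroup; +-commutativeSemigroup)
  open import Algebra.Properties.Ring (CommutativeRing.ring commutativeRing)
    using (-‿distribˡ-*; -‿distribʳ-*)
  open import Algebra.Properties.Group +-group using (⁻¹-involutive; ε⁻¹≈ε)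
  open import Algebra.Properties.AbelianGroup +-abelianGroup using (⁻¹-∙-comm)
  open import Algebra.Properties.CommutativeSemigroup +-commutativeSemigroup using (interchange)
  open import Algebra.Properties.Semiring.Mult.TCOptimised semiring using (1+×; ×-homo-+; ×1-homo-*)
    renaming (_×_ to _·_)

  -- The ring solver below works with integer coefficients, interpreted in R through ι.

  ι : ℤ → R
  ι (ℤ.+ n)  = n · 1#
  ι -[1+ n ] = - (suc n · 1#)

  ι-⊖ : ∀ m n → ι (m ⊖ n) ≡ (m · 1#) - (n · 1#)
  ι-⊖ m       zero    = sym (trans (cong (m · 1# +_) ε⁻¹≈ε) (+-identityʳ _))
  ι-⊖ zero    (suc n) = sym (+-identˡ _)
  ι-⊖ (suc m) (suc n) = begin
    ι (suc m ⊖ suc n)                  ≡⟨ cong ι (ℤ.[1+m]⊖[1+n]≡m⊖n m n) ⟩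
    ι (m ⊖ n)                          ≡⟨ ι-⊖ m n ⟩
    a - b                              ≡⟨ sym (+-identˡ _) ⟩
    0# + (a - b)                       ≡⟨ cong (_+ (a - b)) (sym (-‿inverseʳ 1#)) ⟩
    (1# - 1#) + (a - b)                ≡⟨ interchange 1# (- 1#) a (- b) ⟩
    (1# + a) + (- 1# + - b)            ≡⟨ cong ((1# + a) +_) (⁻¹-∙-comm 1# b) ⟩
    (1# + a) - (1# + b)                ≡⟨ sym (cong₂ _-_ (1+× m 1#) (1+× n 1#)) ⟩
    (suc m · 1#) - (suc n · 1#)        ∎
    where
    open ≡-Reasoning
    a b : R
    a = m · 1#
    b = n · 1#

  ι-+ : ∀ i j → ι (i ℤ.+ j) ≡ ι i + ι j
  ι-+ -[1+ m ] -[1+ n ] = begin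
    - (suc (suc m ℕ.+ n) · 1#)          ≡⟨ cong (λ k → - (suc k · 1#)) (sym (ℕ.+-suc m n)) ⟩
    - ((suc m ℕ.+ suc n) · 1#)          ≡⟨ cong (λ x → - x) (×-homo-+ 1# (suc m) (suc n)) ⟩
    - (suc m · 1# + suc n · 1#)         ≡⟨ sym (⁻¹-∙-comm _ _) ⟩
    - (suc m · 1#) + - (suc n · 1#)     ∎
    where open ≡-Reasoning
  ι-+ -[1+ m ] (ℤ.+ n)  = trans (ι-⊖ n (suc m)) (+-comm _ _)
  ι-+ (ℤ.+ m)  -[1+ n ] = ι-⊖ m (suc n)
  ι-+ (ℤ.+ m)  (ℤ.+ n)  = ×-homo-+ 1# m n

  ι-neg : ∀ i → ι (ℤ.- i) ≡ - ι i
  ι-neg (ℤ.+ zero)    = sym ε⁻¹≈ε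
  ι-neg (ℤ.+ (suc n)) = refl
  ι-neg -[1+ n ]      = sym (⁻¹-involutive _)

  signed : Sign → R → R
  signed Sign.+ x = x
  signed Sign.- x = - x

  ι-◃ : ∀ s n → ι (s ℤ.◃ n) ≡ signed s (n · 1#)
  ι-◃ Sign.+ zero    = refl
  ι-◃ Sign.- zero    = sym ε⁻¹≈ε
  ι-◃ Sign.+ (suc n) = refl
  ι-◃ Sign.- (suc n) = refl

  signed-* : ∀ s t x y → signed (s Sign.* t) (x * y) ≡ signed s x * signed t y
  signed-* Sign.+ Sign.+ x y = refl
  signed-* Sign.+ Sign.- x y = -‿distribʳ-* x y
  signed-* Sign.- Sign.+ x y = -‿distribˡ-* x y
  signed-* Sign.- Sign.- x y = begin
    x * y           ≡⟨ sym (⁻¹-involutive _) ⟩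
    - (- (x * y))   ≡⟨ cong (λ z → - z) (-‿distribˡ-* x y) ⟩
    - (- x * y)     ≡⟨ -‿distribʳ-* (- x) y ⟩
    - x * - y       ∎
    where open ≡-Reasoning

  ι-signAbs : ∀ i → ι i ≡ signed (ℤ.sign i) (ℤ.∣ i ∣ · 1#)
  ι-signAbs i = trans (cong ι (sym (ℤ.◃-inverse i))) (ι-◃ (ℤ.sign i) ℤ.∣ i ∣)

  ι-* : ∀ i j → ι (i ℤ.* j) ≡ ι i * ι j
  ι-* i j = begin
    ι (i ℤ.* j)                                ≡⟨ ι-◃ (s Sign.* t) (a ℕ.* b) ⟩
    signed (s Sign.* t) ((a ℕ.* b) · 1#)       ≡⟨ cong (signed (s Sign.* t)) (×1-homo-* a b) ⟩
    signed (s Sign.* t) ((a · 1#) * (b · 1#))  ≡⟨ signed-* s t (a · 1#) (b · 1#) ⟩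
    signed s (a · 1#) * signed t (b · 1#)      ≡⟨ sym (cong₂ _*_ (ι-signAbs i) (ι-signAbs j)) ⟩
    ι i * ι j                                  ∎
    where
    open ≡-Reasoning
    s t : Sign
    s = ℤ.sign i
    t = ℤ.sign j
    a b : ℕ
    a = ℤ.∣ i ∣
    b = ℤ.∣ j ∣

  ι-homomorphism : ℤ.+-*-rawRing ACR.-Raw-AlmostCommutative⟶ ACR.fromCommutativeRing commutativeRing
  ι-homomorphism = record
    { ⟦_⟧ = ι ; +-homo = ι-+ ; *-homo = ι-* ; -‿homo = ι-neg
    ; 0-homo = refl ; 1-homo = refl }

  ι-≟ : ∀ i j → Maybe (ι i ≡ ι j)
  ι-≟ i j with i ℤ.≟ j
  ... | yes refl = just refl
  ... | no _     = nothing

  open import Algebra.Solver.Ring ℤ.+-*-rawRing (ACR.fromCommutativeRing commutativeRing) ι-homomorphism ι-≟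
    public

  <⇒≢ : ∀ {x y} → x < y → x ≢ y
  <⇒≢ {x} x<x refl = <-irrefl x x<x

  pos⇒≢0 : ∀ {x} → 0# < x → x ≢ 0#
  pos⇒≢0 0<x x≡0 = <⇒≢ 0<x (sym x≡0)

  ≤-refl : ∀ {x} → x ≤ x
  ≤-refl = inj₂ refl

  <-≤-trans : ∀ {x y z} → x < y → y ≤ z → x < z
  <-≤-trans x<y (inj₁ y<z)  = <-trans x<y y<z
  <-≤-trans x<y (inj₂ refl) = x<y

  ≤-trans : ∀ {x y z} → x ≤ y → y ≤ z → x ≤ z
  ≤-trans (inj₁ x<y)  y≤z = inj₁ (<-≤-trans x<y y≤z)
  ≤-trans (inj₂ refl) y≤z = y≤z

  _≟0 : ∀ x → Dec (x ≡ 0#)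
  x ≟0 with <-tri x 0#
  ... | inj₁ x<0        = no (<⇒≢ x<0)
  ... | inj₂ (inj₁ x≡0) = yes x≡0
  ... | inj₂ (inj₂ 0<x) = no (λ x≡0 → <⇒≢ 0<x (sym x≡0))

  +-monoˡ-≤ : ∀ {x y} z → x ≤ y → x + z ≤ y + z
  +-monoˡ-≤ z (inj₁ x<y)  = inj₁ (+-mono-< z x<y)
  +-monoˡ-≤ z (inj₂ refl) = ≤-refl

  x≤x+y : ∀ x {y} → 0# ≤ y → x ≤ x + y
  x≤x+y x {y} 0≤y = subst₂ _≤_ (+-identˡ x) (+-comm y x) (+-monoˡ-≤ x 0≤y)

  +-nonneg : ∀ {x y} → 0# ≤ x → 0# ≤ y → 0# ≤ x + y
  +-nonneg 0≤x 0≤y = ≤-trans 0≤x (x≤x+y _ 0≤y)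

  +-pos : ∀ {x y} → 0# < x → 0# ≤ y → 0# < x + y
  +-pos 0<x 0≤y = <-≤-trans 0<x (x≤x+y _ 0≤y)

  x≤1⇒0≤1-x : ∀ {x} → x ≤ 1# → 0# ≤ 1# - x
  x≤1⇒0≤1-x {x} x≤1 = subst (_≤ 1# - x) (-‿inverseʳ x) (+-monoˡ-≤ (- x) x≤1)

  *-nonneg : ∀ {x y} → 0# ≤ x → 0# ≤ y → 0# ≤ x * y
  *-nonneg (inj₁ 0<x) (inj₁ 0<y) = inj₁ (*-pos 0<x 0<y)
  *-nonneg {x} _      (inj₂ refl) = inj₂ (sym (zeroʳ x))
  *-nonneg {y = y} (inj₂ refl) _  = inj₂ (sym (zeroˡ y))

  neg-pos : ∀ {x} → x < 0# → 0# < - x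
  neg-pos {x} x<0 = subst₂ _<_ (-‿inverseʳ x) (+-identˡ (- x)) (+-mono-< (- x) x<0)

  square-pos : ∀ {x} → x ≢ 0# → 0# < x * x
  square-pos {x} x≢0 with <-tri 0# x
  ... | inj₁ 0<x        = *-pos 0<x 0<x
  ... | inj₂ (inj₁ 0≡x) = ⊥-elim (x≢0 (sym 0≡x))
  ... | inj₂ (inj₂ x<0) = subst (0# <_) (solve 1 (λ x → (:- x) :* (:- x) := x :* x) refl x)
                                (*-pos (neg-pos x<0) (neg-pos x<0))

  square-nonneg : ∀ x → 0# ≤ x * x
  square-nonneg x with x ≟0
  ... | yes refl = inj₂ (sym (zeroˡ 0#))
  ... | no x≢0   = inj₁ (square-pos x≢0)

  0<1 : 0# < 1#
  0<1 = subst (0# <_) (*-identˡ 1#) (square-pos (λ 1≡0 → 0≢1 (sym 1≡0)))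

  0<2 : 0# < 1# + 1#
  0<2 = +-pos 0<1 (inj₁ 0<1)

  2≢0 : 1# + 1# ≢ 0#
  2≢0 = pos⇒≢0 0<2

  *-nonzero : ∀ {x y} → x ≢ 0# → y ≢ 0# → x * y ≢ 0#
  *-nonzero {x} {y} x≢0 y≢0 xy≡0 with *-inv x x≢0
  ... | x⁻¹ , x⁻¹x≡1 = y≢0 (begin
    y               ≡⟨ sym (*-identˡ y) ⟩
    1# * y          ≡⟨ cong (_* y) (sym x⁻¹x≡1) ⟩
    (x⁻¹ * x) * y   ≡⟨ *-assoc x⁻¹ x y ⟩
    x⁻¹ * (x * y)   ≡⟨ cong (x⁻¹ *_) xy≡0 ⟩
    x⁻¹ * 0#        ≡⟨ zeroʳ x⁻¹ ⟩
    0#              ∎)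
    where open ≡-Reasoning

  inverse-pos : ∀ {x y} → 0# < x → y * x ≡ 1# → 0# < y
  inverse-pos {x} {y} 0<x yx≡1 with <-tri 0# y
  ... | inj₁ 0<y        = 0<y
  ... | inj₂ (inj₁ refl) = ⊥-elim (0≢1 (trans (sym (zeroˡ x)) yx≡1))
  ... | inj₂ (inj₂ y<0) = ⊥-elim (<-irrefl 0# (<-trans 0<1 1<0))
    where
    0<-1 : 0# < - 1#
    0<-1 = subst (0# <_) (trans (sym (-‿distribˡ-* y x)) (cong (λ z → - z) yx≡1))
                 (*-pos (neg-pos y<0) 0<x)
    1<0 : 1# < 0#
    1<0 = subst₂ _<_ (+-identˡ 1#) (+-invˡ 1#) (+-mono-< 1# 0<-1)

  -- 1 ± ε (x + x) = ε ((1 ± x)² + q)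
  ε[x+x]-bounds : ∀ {ε} x {q} → 0# < ε → 0# ≤ q → ε * (1# + (x * x + q)) ≡ 1# →
                  (0# ≤ 1# + ε * (x + x)) × (0# ≤ 1# - (ε * (x + x)))
  ε[x+x]-bounds {ε} x {q} 0<ε 0≤q ε[1+x²+q]≡1 =
    subst (0# ≤_) (sym plus) (nonneg (1# + x)) , subst (0# ≤_) (sym minus) (nonneg (1# - x))
    where
    open ≡-Reasoning
    nonneg : ∀ z → 0# ≤ ε * (z * z + q)
    nonneg z = *-nonneg (inj₁ 0<ε) (+-nonneg (square-nonneg z) 0≤q)
    plus : 1# + ε * (x + x) ≡ ε * ((1# + x) * (1# + x) + q)
    plus = begin
      1# + ε * (x + x)
        ≡⟨ cong (_+ ε * (x + x)) (sym ε[1+x²+q]≡1) ⟩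
      ε * (1# + (x * x + q)) + ε * (x + x)
        ≡⟨ solve 3 (λ ε x q → ε :* (con 1ℤ :+ (x :* x :+ q)) :+ ε :* (x :+ x)
                           := ε :* ((con 1ℤ :+ x) :* (con 1ℤ :+ x) :+ q)) refl ε x q ⟩
      ε * ((1# + x) * (1# + x) + q)
        ∎
    minus : 1# - (ε * (x + x)) ≡ ε * ((1# - x) * (1# - x) + q)
    minus = begin
      1# - (ε * (x + x))
        ≡⟨ cong (_- (ε * (x + x))) (sym ε[1+x²+q]≡1) ⟩
      (ε * (1# + (x * x + q))) - (ε * (x + x))
        ≡⟨ solve 3 (λ ε x q → ε :* (con 1ℤ :+ (x :* x :+ q)) :- ε :* (x :+ x)
                           := ε :* ((con 1ℤ :- x) :* (con 1ℤ :- x) :+ q)) refl ε x q ⟩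
      ε * ((1# - x) * (1# - x) + q)
        ∎

module FiniteSums (ℝ : RealField) where

  open import Data.Nat using (zero; suc)
  open import Data.Fin using (Fin; punchIn)
  open import Data.Fin.Properties using (punchInᵢ≢i)
  open import Data.Vec.Functional using (_∷_)
  open import Data.Product using (∃; _×_; _,_)
  open import Relation.Binary.PropositionalEquality
  open import Function using (_∘_)

  open RealField ℝ renaming (Carrier to R)
  open Hypermatrices ℝ
  open OrderedField ℝ
  open import Algebra.Properties.Semiring.Sum semiring public
    using (sum; sum-syntax; sum-cong-≗; ∑-distrib-+; ∑-comm; sum-remove; *-distribˡ-sum; sum-replicate-zero)

  sumFin≡sum : ∀ n (f : Fin n → R) → sumFin n f ≡ sum f
  sumFin≡sum zero    f = refl
  sumFin≡sum (suc n) f = cong (f Fin.zero +_) (sumFin≡sum n (f ∘ Fin.suc))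

  sum-nonneg : ∀ {n} (f : Fin n → R) → (∀ k → 0# ≤ f k) → 0# ≤ sum f
  sum-nonneg {zero}  f 0≤f = ≤-refl
  sum-nonneg {suc n} f 0≤f = +-nonneg (0≤f Fin.zero) (sum-nonneg (f ∘ Fin.suc) (0≤f ∘ Fin.suc))

  sum-zero : ∀ {n} (f : Fin n → R) → (∀ k → f k ≡ 0#) → sum f ≡ 0#
  sum-zero {n} f f≡0 = trans (sum-cong-≗ f≡0) (sum-replicate-zero n)

  sum-single : ∀ {n} (f : Fin n → R) p → (∀ k → k ≢ p → f k ≡ 0#) → sum f ≡ f p
  sum-single {suc n} f p vanish = begin
    sum f                              ≡⟨ sum-remove {i = p} f ⟩
    f p + sum (f ∘ punchIn p)          ≡⟨ cong (f p +_) (sum-zero _ (λ k → vanish _ (punchInᵢ≢i p k))) ⟩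
    f p + 0#                           ≡⟨ +-identityʳ (f p) ⟩
    f p                                ∎
    where open ≡-Reasoning

  sum≡term+nonneg : ∀ {n} (f : Fin n → R) → (∀ k → 0# ≤ f k) →
                    ∀ p → ∃ λ q → 0# ≤ q × sum f ≡ f p + q
  sum≡term+nonneg {suc n} f 0≤f p =
    sum (f ∘ punchIn p) , sum-nonneg _ (0≤f ∘ punchIn p) , sum-remove {i = p} f

  ∑[f-a*g]≡∑f-a*∑g : ∀ {m} (f g : Fin m → R) a →
                     ∑[ k < m ] (f k - (a * g k)) ≡ (∑[ k < m ] f k) - (a * ∑[ k < m ] g k)
  ∑[f-a*g]≡∑f-a*∑g f g a = begin
    ∑[ k < _ ] (f k - (a * g k))
      ≡⟨ sum-cong-≗ (λ k → solve 3 (λ f a g → f :- a :* g := f :+ (:- a) :* g) refl (f k) a (g k)) ⟩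
    ∑[ k < _ ] (f k + (- a) * g k)
      ≡⟨ ∑-distrib-+ f (λ k → (- a) * g k) ⟩
    ∑[ k < _ ] f k + ∑[ k < _ ] ((- a) * g k)
      ≡⟨ cong (∑[ k < _ ] f k +_) (sym (*-distribˡ-sum (- a) g)) ⟩
    ∑[ k < _ ] f k + (- a) * ∑[ k < _ ] g k
      ≡⟨ solve 3 (λ f a g → f :+ (:- a) :* g := f :- a :* g) refl (sum f) a (sum g) ⟩
    (∑[ k < _ ] f k) - (a * ∑[ k < _ ] g k)
      ∎
    where open ≡-Reasoning

  sumIdx-suc : ∀ m n (f : Index (suc m) n → R) → sumIdx (suc m) n f ≡ ∑[ x < n ] sumIdx m n (f ∘ (x ∷_))
  sumIdx-suc m n f = sumFin≡sum n _

  sumIdx-cong : ∀ m n {f g : Index m n → R} → (∀ t → f t ≡ g t) → sumIdx m n f ≡ sumIdx m n g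
  sumIdx-cong zero    n f≗g = f≗g _
  sumIdx-cong (suc m) n {f} {g} f≗g = begin
    sumIdx (suc m) n f                     ≡⟨ sumIdx-suc m n f ⟩
    ∑[ x < n ] sumIdx m n (f ∘ (x ∷_))     ≡⟨ sum-cong-≗ (λ x → sumIdx-cong m n (f≗g ∘ (x ∷_))) ⟩
    ∑[ x < n ] sumIdx m n (g ∘ (x ∷_))     ≡⟨ sym (sumIdx-suc m n g) ⟩
    sumIdx (suc m) n g                     ∎
    where open ≡-Reasoning

  sumIdx-+ : ∀ m n (f g : Index m n → R) → sumIdx m n (λ t → f t + g t) ≡ sumIdx m n f + sumIdx m n g
  sumIdx-+ zero    n f g = refl
  sumIdx-+ (suc m) n f g = begin
    sumIdx (suc m) n (λ t → f t + g t)
      ≡⟨ sumIdx-suc m n (λ t → f t + g t) ⟩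
    ∑[ x < n ] sumIdx m n (λ t → f (x ∷ t) + g (x ∷ t))
      ≡⟨ sum-cong-≗ (λ x → sumIdx-+ m n (f ∘ (x ∷_)) (g ∘ (x ∷_))) ⟩
    ∑[ x < n ] (sumIdx m n (f ∘ (x ∷_)) + sumIdx m n (g ∘ (x ∷_)))
      ≡⟨ ∑-distrib-+ (λ x → sumIdx m n (f ∘ (x ∷_))) (λ x → sumIdx m n (g ∘ (x ∷_))) ⟩
    ∑[ x < n ] sumIdx m n (f ∘ (x ∷_)) + ∑[ x < n ] sumIdx m n (g ∘ (x ∷_))
      ≡⟨ sym (cong₂ _+_ (sumIdx-suc m n f) (sumIdx-suc m n g)) ⟩
    sumIdx (suc m) n f + sumIdx (suc m) n g
      ∎
    where open ≡-Reasoning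

  sumIdx-* : ∀ m n c (f : Index m n → R) → sumIdx m n (λ t → c * f t) ≡ c * sumIdx m n f
  sumIdx-* zero    n c f = refl
  sumIdx-* (suc m) n c f = begin
    sumIdx (suc m) n (λ t → c * f t)       ≡⟨ sumIdx-suc m n (λ t → c * f t) ⟩
    ∑[ x < n ] sumIdx m n (λ t → c * f (x ∷ t))
                                           ≡⟨ sum-cong-≗ (λ x → sumIdx-* m n c (f ∘ (x ∷_))) ⟩
    ∑[ x < n ] (c * sumIdx m n (f ∘ (x ∷_)))
                                           ≡⟨ sym (*-distribˡ-sum c (λ x → sumIdx m n (f ∘ (x ∷_)))) ⟩
    c * ∑[ x < n ] sumIdx m n (f ∘ (x ∷_)) ≡⟨ cong (c *_) (sym (sumIdx-suc m n f)) ⟩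
    c * sumIdx (suc m) n f                 ∎
    where open ≡-Reasoning

  sumIdx-∑ : ∀ m n {K} (F : Fin K → Index m n → R) →
             sumIdx m n (λ t → ∑[ k < K ] F k t) ≡ ∑[ k < K ] sumIdx m n (F k)
  sumIdx-∑ zero    n F = refl
  sumIdx-∑ (suc m) n {K} F = begin
    sumIdx (suc m) n (λ t → ∑[ k < K ] F k t)
      ≡⟨ sumIdx-suc m n (λ t → ∑[ k < K ] F k t) ⟩
    ∑[ x < n ] sumIdx m n (λ t → ∑[ k < K ] F k (x ∷ t))
      ≡⟨ sum-cong-≗ (λ x → sumIdx-∑ m n (λ k → F k ∘ (x ∷_))) ⟩
    ∑[ x < n ] ∑[ k < K ] sumIdx m n (F k ∘ (x ∷_))
      ≡⟨ ∑-comm (λ x k → sumIdx m n (F k ∘ (x ∷_))) ⟩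
    ∑[ k < K ] ∑[ x < n ] sumIdx m n (F k ∘ (x ∷_))
      ≡⟨ sum-cong-≗ (λ k → sym (sumIdx-suc m n (F k))) ⟩
    ∑[ k < K ] sumIdx (suc m) n (F k)
      ∎
    where open ≡-Reasoning

  rowSum-cong : ∀ {d n} {A B : Hypermatrix d n} → A ≐ B → ∀ j → rowSum A j ≡ rowSum B j
  rowSum-cong {zero}  A≐B j = refl
  rowSum-cong {suc e} A≐B j = sumIdx-cong e _ (A≐B ∘ (j ∷_))

  rowSum-+ : ∀ {d n} (A B : Hypermatrix d n) j → rowSum (λ i → A i + B i) j ≡ rowSum A j + rowSum B j
  rowSum-+ {zero}  A B j = sym (+-identˡ 0#)
  rowSum-+ {suc e} A B j = sumIdx-+ e _ (A ∘ (j ∷_)) (B ∘ (j ∷_))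

  rowSum-* : ∀ {d n} c (A : Hypermatrix d n) j → rowSum (λ i → c * A i) j ≡ c * rowSum A j
  rowSum-* {zero}  c A j = sym (zeroʳ c)
  rowSum-* {suc e} c A j = sumIdx-* e _ c (A ∘ (j ∷_))

  rowSum-∑ : ∀ {d n K} (F : Fin K → Hypermatrix d n) j →
             rowSum (λ i → ∑[ k < K ] F k i) j ≡ ∑[ k < K ] rowSum (F k) j
  rowSum-∑ {zero}  {K = K} F j = sym (sum-replicate-zero K)
  rowSum-∑ {suc e} F j = sumIdx-∑ e _ (λ k → F k ∘ (j ∷_))

module LinearAlgebra (ℝ : RealField) where

  open import Data.Nat as ℕ using (ℕ; zero; suc; s≤s)
  import Data.Nat.Properties as ℕ
  open import Data.Fin using (Fin; punchIn)
  open import Data.Vec.Functional using (insertAt)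
  open import Data.Vec.Functional.Properties using (insertAt-lookup; insertAt-punchIn)
  open import Data.Product using (∃; ∃₂; _×_; _,_)
  open import Data.Sum using (_⊎_; inj₁; inj₂)
  open import Relation.Nullary using (yes; no)
  open import Relation.Binary.PropositionalEquality
  open import Function using (_∘_)
  open import Data.Integer using (0ℤ; 1ℤ)

  open RealField ℝ renaming (Carrier to R)
  open OrderedField ℝ
  open FiniteSums ℝ

  InKernel : ∀ {n m} → (Fin n → Fin m → R) → (Fin m → R) → Set
  InKernel {m = m} M y = ∀ j → ∑[ k < m ] (M j k * y k) ≡ 0#

  NontrivialKernel : ∀ {n m} → (Fin n → Fin m → R) → Set
  NontrivialKernel M = ∃₂ λ y p → y p ≢ 0# × InKernel M y

  zero-or-pivot : ∀ {m} (g : Fin m → R) → (∀ k → g k ≡ 0#) ⊎ (∃ λ q → g q ≢ 0#)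
  zero-or-pivot {zero}  g = inj₁ (λ ())
  zero-or-pivot {suc m} g with g Fin.zero ≟0 | zero-or-pivot (g ∘ Fin.suc)
  ... | no g₀≢0   | _                 = inj₂ (Fin.zero , g₀≢0)
  ... | yes _     | inj₂ (q , g≢0)    = inj₂ (Fin.suc q , g≢0)
  ... | yes g₀≡0  | inj₁ g≡0          = inj₁ λ { Fin.zero → g₀≡0 ; (Fin.suc k) → g≡0 k }

  eliminateColumn : ∀ {n m} → (Fin (suc n) → Fin (suc m) → R) → Fin (suc m) → R → Fin n → Fin m → R
  eliminateColumn M q c j k = M (Fin.suc j) (punchIn q k) - ((M (Fin.suc j) q * c) * M Fin.zero (punchIn q k))

  -- Row 0 is solved for the pivot unknown y q; the other rows then reduce to the eliminated system.
  pivotRow-lift : ∀ {n m} (M : Fin (suc n) → Fin (suc m) → R) q c → c * M Fin.zero q ≡ 1# →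
                  NontrivialKernel (eliminateColumn M q c) → NontrivialKernel M
  pivotRow-lift {n} {m} M q c cM₀q≡1 (y′ , p , y′p≢0 , M′y′≡0) =
    y , punchIn q p , subst (_≢ 0#) (sym (insertAt-punchIn y′ q y_q p)) y′p≢0 ,
    λ { Fin.zero → row₀ ; (Fin.suc j) → row j }
    where
    S : Fin (suc n) → R
    S j = ∑[ k < m ] (M j (punchIn q k) * y′ k)
    y_q : R
    y_q = - (c * S Fin.zero)
    y : Fin (suc m) → R
    y = insertAt y′ q y_q

    ∑-y : ∀ j → ∑[ k < suc m ] (M j k * y k) ≡ M j q * y_q + S j
    ∑-y j = trans (sum-remove {i = q} (λ k → M j k * y k))
      (cong₂ _+_ (cong (M j q *_) (insertAt-lookup y′ q y_q))
                 (sum-cong-≗ (λ k → cong (M j (punchIn q k) *_) (insertAt-punchIn y′ q y_q k))))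

    row₀ : ∑[ k < suc m ] (M Fin.zero k * y k) ≡ 0#
    row₀ = begin
      ∑[ k < suc m ] (M Fin.zero k * y k)
        ≡⟨ ∑-y Fin.zero ⟩
      M Fin.zero q * y_q + S Fin.zero
        ≡⟨ solve 3 (λ a c s → a :* (:- (c :* s)) :+ s := (con 1ℤ :- c :* a) :* s)
                   refl (M Fin.zero q) c (S Fin.zero) ⟩
      (1# - (c * M Fin.zero q)) * S Fin.zero
        ≡⟨ cong (λ z → (1# - z) * S Fin.zero) cM₀q≡1 ⟩
      (1# - 1#) * S Fin.zero
        ≡⟨ solve 1 (λ s → (con 1ℤ :- con 1ℤ) :* s := con 0ℤ) refl (S Fin.zero) ⟩
      0#
        ∎
      where open ≡-Reasoning

    row : ∀ j → ∑[ k < suc m ] (M (Fin.suc j) k * y k) ≡ 0#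
    row j = begin
      ∑[ k < suc m ] (M (Fin.suc j) k * y k)
        ≡⟨ ∑-y (Fin.suc j) ⟩
      M (Fin.suc j) q * y_q + S (Fin.suc j)
        ≡⟨ solve 4 (λ a c s t → a :* (:- (c :* s)) :+ t := t :- (a :* c) :* s)
                   refl (M (Fin.suc j) q) c (S Fin.zero) (S (Fin.suc j)) ⟩
      S (Fin.suc j) - (λⱼ * S Fin.zero)
        ≡⟨ sym (∑[f-a*g]≡∑f-a*∑g (λ k → M (Fin.suc j) (punchIn q k) * y′ k)
                                 (λ k → M Fin.zero (punchIn q k) * y′ k) λⱼ) ⟩
      ∑[ k < m ] ((M (Fin.suc j) (punchIn q k) * y′ k) - (λⱼ * (M Fin.zero (punchIn q k) * y′ k)))
        ≡⟨ sum-cong-≗ (λ k → solve 4 (λ a l b z → a :* z :- l :* (b :* z) := (a :- l :* b) :* z)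
                                     refl _ λⱼ _ (y′ k)) ⟩
      ∑[ k < m ] (eliminateColumn M q c j k * y′ k)
        ≡⟨ M′y′≡0 j ⟩
      0#
        ∎
      where
      open ≡-Reasoning
      λⱼ : R
      λⱼ = M (Fin.suc j) q * c

  zeroRow-lift : ∀ {n m} (M : Fin (suc n) → Fin m → R) → (∀ k → M Fin.zero k ≡ 0#) →
                 NontrivialKernel (M ∘ Fin.suc) → NontrivialKernel M
  zeroRow-lift M row₀≡0 (y , p , yp≢0 , My≡0) = y , p , yp≢0 , λ
    { Fin.zero    → sum-zero _ (λ k → trans (cong (_* y k) (row₀≡0 k)) (zeroˡ (y k)))
    ; (Fin.suc j) → My≡0 j }

  nontrivialKernel : ∀ {n m} → n ℕ.< m → (M : Fin n → Fin m → R) → NontrivialKernel M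
  nontrivialKernel {zero}  {suc m} _ M = (λ _ → 1#) , Fin.zero , (λ 1≡0 → 0≢1 (sym 1≡0)) , λ ()
  nontrivialKernel {suc n} {suc m} (s≤s n<m) M with zero-or-pivot (M Fin.zero)
  ... | inj₁ row₀≡0 = zeroRow-lift M row₀≡0 (nontrivialKernel (ℕ.m≤n⇒m≤1+n n<m) (M ∘ Fin.suc))
  ... | inj₂ (q , M₀q≢0) with c , cM₀q≡1 ← *-inv (M Fin.zero q) M₀q≢0 =
    pivotRow-lift M q c cM₀q≡1 (nontrivialKernel n<m (eliminateColumn M q c))

module Perturbation (ℝ : RealField) where

  open import Data.Product using (_,_; proj₁; proj₂)
  open import Relation.Nullary using (¬_)
  open import Relation.Binary.PropositionalEquality
  open import Data.Integer using (0ℤ; 1ℤ)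

  open RealField ℝ renaming (Carrier to R)
  open Hypermatrices ℝ
  open OrderedField ℝ
  open FiniteSums ℝ

  ½ : R
  ½ = proj₁ (*-inv (1# + 1#) 2≢0)

  ½*2≡1 : ½ * (1# + 1#) ≡ 1#
  ½*2≡1 = proj₂ (*-inv (1# + 1#) 2≢0)

  ½+½≡1 : ½ + ½ ≡ 1#
  ½+½≡1 = trans (solve 1 (λ h → h :+ h := h :* (con 1ℤ :+ con 1ℤ)) refl ½) ½*2≡1

  0<½ : 0# < ½
  0<½ = inverse-pos 0<2 ½*2≡1

  ½<1 : ½ < 1#
  ½<1 = subst₂ _<_ (+-identˡ ½) ½+½≡1 (+-mono-< ½ 0<½)

  -- A · (1 ± u) stay in 𝒩₀, have midpoint A, and differ wherever A u ≠ 0.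
  perturbation-not-extreme :
    ∀ {d n r} {A : Hypermatrix d n} → InN₀ d n r A →
    (u : Hypermatrix d n) → Symmetric u → (∀ i → 0# ≤ 1# + u i) → (∀ i → 0# ≤ 1# - u i) →
    (∀ j → rowSum (λ i → A i * u i) j ≡ 0#) →
    ∀ i → 0# < A i → u i ≢ 0# → ¬ IsExtremePoint (InN₀ d n r) A
  perturbation-not-extreme {d} {n} {r} {A} (offDiagonal , symmetric , nonneg , rows)
    u u-symmetric 0≤1+u 0≤1-u Au-rows i 0<Aᵢ uᵢ≢0 (_ , extreme) =
    extreme B C segment B≉C (½ , 0<½ , ½<1 , A≐midpoint)
    where
    B C : Hypermatrix d n
    B i = A i * (1# + u i)
    C i = A i * (1# - u i)

    comb-factor : ∀ s i → comb s B C i ≡ A i * (s * (1# + u i) + (1# - s) * (1# - u i))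
    comb-factor s i = solve 3 (λ s a u → s :* (a :* (con 1ℤ :+ u)) :+ (con 1ℤ :- s) :* (a :* (con 1ℤ :- u))
                                      := a :* (s :* (con 1ℤ :+ u) :+ (con 1ℤ :- s) :* (con 1ℤ :- u)))
                              refl s (A i) (u i)

    comb-linear : ∀ s i → comb s B C i ≡ A i + ((s + s) - 1#) * (A i * u i)
    comb-linear s i = solve 3 (λ s a u → s :* (a :* (con 1ℤ :+ u)) :+ (con 1ℤ :- s) :* (a :* (con 1ℤ :- u))
                                      := a :+ ((s :+ s) :- con 1ℤ) :* (a :* u))
                              refl s (A i) (u i)

    segment : ∀ s → 0# ≤ s → s ≤ 1# → InN₀ d n r (comb s B C)
    segment s 0≤s s≤1 = offDiagonal′ , symmetric′ , nonneg′ , rows′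
      where
      offDiagonal′ : StronglyOffDiagonal (comb s B C)
      offDiagonal′ i k l k≢l iₖ≡iₗ =
        trans (comb-factor s i) (trans (cong (_* _) (offDiagonal i k l k≢l iₖ≡iₗ)) (zeroˡ _))
      symmetric′ : Symmetric (comb s B C)
      symmetric′ i π =
        cong₂ (λ a v → s * (a * (1# + v)) + (1# - s) * (a * (1# - v))) (symmetric i π) (u-symmetric i π)
      nonneg′ : Nonnegative (comb s B C)
      nonneg′ i = subst (0# ≤_) (sym (comb-factor s i))
        (*-nonneg (nonneg i) (+-nonneg (*-nonneg 0≤s (0≤1+u i)) (*-nonneg (x≤1⇒0≤1-x s≤1) (0≤1-u i))))
      rows′ : ∀ j → rowSum (comb s B C) j ≡ r j
      rows′ j = begin
        rowSum (comb s B C) j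
          ≡⟨ rowSum-cong (comb-linear s) j ⟩
        rowSum (λ i → A i + c * (A i * u i)) j
          ≡⟨ rowSum-+ A _ j ⟩
        rowSum A j + rowSum (λ i → c * (A i * u i)) j
          ≡⟨ cong (rowSum A j +_) (rowSum-* c (λ i → A i * u i) j) ⟩
        rowSum A j + c * rowSum (λ i → A i * u i) j
          ≡⟨ cong₂ (λ a b → a + c * b) (rows j) (Au-rows j) ⟩
        r j + c * 0#
          ≡⟨ solve 2 (λ r c → r :+ c :* con 0ℤ := r) refl (r j) c ⟩
        r j
          ∎
        where
        open ≡-Reasoning
        c : R
        c = (s + s) - 1#

    B≉C : ¬ (B ≐ C)
    B≉C B≐C = *-nonzero 2≢0 (*-nonzero (pos⇒≢0 0<Aᵢ) uᵢ≢0) (begin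
      (1# + 1#) * (A i * u i)
        ≡⟨ solve 2 (λ a u → (con 1ℤ :+ con 1ℤ) :* (a :* u) := a :* (con 1ℤ :+ u) :- a :* (con 1ℤ :- u))
                   refl (A i) (u i) ⟩
      B i - C i
        ≡⟨ cong (_- C i) (B≐C i) ⟩
      C i - C i
        ≡⟨ -‿inverseʳ (C i) ⟩
      0#
        ∎)
      where open ≡-Reasoning

    A≐midpoint : A ≐ comb ½ B C
    A≐midpoint i = sym (begin
      comb ½ B C i                         ≡⟨ comb-linear ½ i ⟩
      A i + ((½ + ½) - 1#) * (A i * u i)   ≡⟨ cong (λ h → A i + (h - 1#) * (A i * u i)) ½+½≡1 ⟩
      A i + (1# - 1#) * (A i * u i)        ≡⟨ solve 2 (λ a b → a :+ (con 1ℤ :- con 1ℤ) :* b := a) refl _ _ ⟩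
      A i                                  ∎)
      where open ≡-Reasoning

module Classes (ℝ : RealField) where

  import Data.Nat as ℕ
  open import Data.Fin using (Fin)
  import Data.Fin.Properties as Fin
  open import Data.Fin.Permutation using (Permutation′; _⟨$⟩ʳ_)
  open import Data.Product using (∃; _×_; _,_; proj₁; proj₂)
  open import Data.Empty using (⊥-elim)
  open import Function using (_∘_)
  open import Function.Definitions using (Injective)
  open import Relation.Nullary using (¬_; Dec; yes; no)
  open import Relation.Binary.Definitions using (DecidableEquality)
  open import Relation.Binary.PropositionalEquality
  open import Data.Integer using (0ℤ; 1ℤ)

  open RealField ℝ renaming (Carrier to R)
  open Hypermatrices ℝ
  open OrderedField ℝ
  open FiniteSums ℝ
  open LinearAlgebra ℝ
  open Perturbation ℝ

  indicator : ∀ {P : Set} → Dec P → R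
  indicator (yes _) = 1#
  indicator (no _)  = 0#

  module _ {d n r} {A : Hypermatrix d n} (A∈N₀ : InN₀ d n r A)
           {K : Set} (_≟_ : DecidableEquality K) (key : Index d n → K)
           (key-symmetric : ∀ i (π : Permutation′ d) → key (λ k → i (π ⟨$⟩ʳ k)) ≡ key i)
           {m} (S : Fin m → K) (S-injective : Injective _≡_ _≡_ S) where

    δ : K → Fin m → R
    δ κ k = indicator (κ ≟ S k)

    δ-S : ∀ k → δ (S k) k ≡ 1#
    δ-S k with S k ≟ S k
    ... | yes _  = refl
    ... | no Sₖ≢Sₖ = ⊥-elim (Sₖ≢Sₖ refl)

    δ-≢ : ∀ {κ k} → κ ≢ S k → δ κ k ≡ 0#
    δ-≢ {κ} {k} κ≢Sₖ with κ ≟ S k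
    ... | yes κ≡Sₖ = ⊥-elim (κ≢Sₖ κ≡Sₖ)
    ... | no _     = refl

    classMatrix : Fin n → Fin m → R
    classMatrix j k = rowSum (λ i → A i * δ (key i) k) j

    -- u is constant, equal to 2 ε yₖ, on the k-th class and vanishes off the classes.
    classes-not-extreme : ∀ (y : Fin m → R) p → y p ≢ 0# → InKernel classMatrix y →
                          (∃ λ i → key i ≡ S p × 0# < A i) → ¬ IsExtremePoint (InN₀ d n r) A
    classes-not-extreme y p yp≢0 My≡0 (i₀ , keyᵢ₀≡Sₚ , 0<Aᵢ₀) =
      perturbation-not-extreme A∈N₀ u u-symmetric (proj₁ ∘ u-bounds) (proj₂ ∘ u-bounds) Au-rows
                               i₀ 0<Aᵢ₀ uᵢ₀≢0
      where
      weight : K → R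
      weight κ = ∑[ k < m ] (y k * δ κ k)

      weight-S : ∀ k → weight (S k) ≡ y k
      weight-S k = trans (sum-single _ k other-classes) (trans (cong (y k *_) (δ-S k)) (*-identityʳ (y k)))
        where
        other-classes : ∀ k′ → k′ ≢ k → y k′ * δ (S k) k′ ≡ 0#
        other-classes k′ k′≢k = trans (cong (y k′ *_) (δ-≢ (k′≢k ∘ S-injective ∘ sym))) (zeroʳ _)

      weight-∉ : ∀ {κ} → (∀ k → κ ≢ S k) → weight κ ≡ 0#
      weight-∉ κ∉S = sum-zero _ (λ k → trans (cong (y k *_) (δ-≢ (κ∉S k))) (zeroʳ _))

      Σy² : R
      Σy² = ∑[ k < m ] (y k * y k)
      0<1+Σy² : 0# < 1# + Σy²
      0<1+Σy² = +-pos 0<1 (sum-nonneg _ (square-nonneg ∘ y))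
      ε : R
      ε = proj₁ (*-inv (1# + Σy²) (pos⇒≢0 0<1+Σy²))
      ε[1+Σy²]≡1 : ε * (1# + Σy²) ≡ 1#
      ε[1+Σy²]≡1 = proj₂ (*-inv (1# + Σy²) (pos⇒≢0 0<1+Σy²))
      0<ε : 0# < ε
      0<ε = inverse-pos 0<1+Σy² ε[1+Σy²]≡1

      u : Hypermatrix d n
      u i = ε * (weight (key i) + weight (key i))

      u-symmetric : Symmetric u
      u-symmetric i π = cong (λ κ → ε * (weight κ + weight κ)) (key-symmetric i π)

      Σy²-split : ∀ κ → ∃ λ q → 0# ≤ q × Σy² ≡ weight κ * weight κ + q
      Σy²-split κ with Fin.any? (λ k → κ ≟ S k)
      ... | yes (k , refl)
        with q , 0≤q , Σy²≡yₖ²+q ← sum≡term+nonneg (λ k → y k * y k) (square-nonneg ∘ y) k =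
        q , 0≤q , trans Σy²≡yₖ²+q (cong (λ w → w * w + q) (sym (weight-S k)))
      ... | no κ∉S = Σy² , sum-nonneg _ (square-nonneg ∘ y) , (begin
        Σy²                         ≡⟨ solve 1 (λ s → s := con 0ℤ :* con 0ℤ :+ s) refl Σy² ⟩
        0# * 0# + Σy²               ≡⟨ cong (λ w → w * w + Σy²) (sym (weight-∉ (λ k → κ∉S ∘ (k ,_)))) ⟩
        weight κ * weight κ + Σy²   ∎)
        where open ≡-Reasoning

      u-bounds : ∀ i → (0# ≤ 1# + u i) × (0# ≤ 1# - u i)
      u-bounds i with q , 0≤q , Σy²≡w²+q ← Σy²-split (key i) =
        ε[x+x]-bounds (weight (key i)) 0<ε 0≤q
          (trans (cong (λ s → ε * (1# + s)) (sym Σy²≡w²+q)) ε[1+Σy²]≡1)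

      x[yz]≡y[xz] : ∀ x y z → x * (y * z) ≡ y * (x * z)
      x[yz]≡y[xz] = solve 3 (λ x y z → x :* (y :* z) := y :* (x :* z)) refl

      Aweight-rows : ∀ j → rowSum (λ i → A i * weight (key i)) j ≡ 0#
      Aweight-rows j = begin
        rowSum (λ i → A i * weight (key i)) j
          ≡⟨ rowSum-cong (λ i → *-distribˡ-sum (A i) (λ k → y k * δ (key i) k)) j ⟩
        rowSum (λ i → ∑[ k < m ] (A i * (y k * δ (key i) k))) j
          ≡⟨ rowSum-∑ (λ k i → A i * (y k * δ (key i) k)) j ⟩
        ∑[ k < m ] rowSum (λ i → A i * (y k * δ (key i) k)) j
          ≡⟨ sum-cong-≗ (λ k → trans (rowSum-cong (λ i → x[yz]≡y[xz] (A i) (y k) (δ (key i) k)) j)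
                                     (rowSum-* (y k) (λ i → A i * δ (key i) k) j)) ⟩
        ∑[ k < m ] (y k * classMatrix j k)
          ≡⟨ sum-cong-≗ (λ k → *-comm (y k) _) ⟩
        ∑[ k < m ] (classMatrix j k * y k)
          ≡⟨ My≡0 j ⟩
        0#
          ∎
        where open ≡-Reasoning

      Au-rows : ∀ j → rowSum (λ i → A i * u i) j ≡ 0#
      Au-rows j = begin
        rowSum (λ i → A i * u i) j
          ≡⟨ rowSum-cong (λ i → solve 3 (λ a ε w → a :* (ε :* (w :+ w)) := (ε :+ ε) :* (a :* w))
                                         refl (A i) ε (weight (key i))) j ⟩
        rowSum (λ i → (ε + ε) * (A i * weight (key i))) j
          ≡⟨ rowSum-* (ε + ε) (λ i → A i * weight (key i)) j ⟩
        (ε + ε) * rowSum (λ i → A i * weight (key i)) j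
          ≡⟨ cong ((ε + ε) *_) (Aweight-rows j) ⟩
        (ε + ε) * 0#
          ≡⟨ zeroʳ (ε + ε) ⟩
        0#
          ∎
        where open ≡-Reasoning

      uᵢ₀≢0 : u i₀ ≢ 0#
      uᵢ₀≢0 = subst (_≢ 0#) (cong (λ w → ε * (w + w)) (sym weightᵢ₀≡yₚ))
        (*-nonzero (pos⇒≢0 0<ε) (subst (_≢ 0#) 2y≡y+y (*-nonzero 2≢0 yp≢0)))
        where
        weightᵢ₀≡yₚ : weight (key i₀) ≡ y p
        weightᵢ₀≡yₚ = trans (cong weight keyᵢ₀≡Sₚ) (weight-S p)
        2y≡y+y : (1# + 1#) * y p ≡ y p + y p
        2y≡y+y = solve 1 (λ y → (con 1ℤ :+ con 1ℤ) :* y := y :+ y) refl (y p)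

    manyClasses-not-extreme : n ℕ.< m → (∀ k → ∃ λ i → key i ≡ S k × 0# < A i) →
                              ¬ IsExtremePoint (InN₀ d n r) A
    manyClasses-not-extreme n<m witness with y , p , yp≢0 , My≡0 ← nontrivialKernel n<m classMatrix =
      classes-not-extreme y p yp≢0 My≡0 (witness p)

module ExtremePoints (ℝ : RealField) where

  import Data.Nat as ℕ
  import Data.Nat.Properties as ℕ
  import Data.Fin as Fin
  import Data.Fin.Properties as Fin
  open import Data.List as List using (List; length)
  open import Data.List.Membership.Propositional.Properties using (∈-lookup)
  open import Data.List.Relation.Unary.All as All using (All)
  open import Data.Product using (∃; _×_; _,_)
  open import Data.Empty using (⊥-elim)
  open import Function.Definitions using (Injective)
  open import Relation.Nullary using (yes; no)
  open import Relation.Binary.PropositionalEquality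

  open RealField ℝ using (0#; _<_)
  open Hypermatrices ℝ
  open OrderedField ℝ using (pos⇒≢0)
  open Counting
  open Classes ℝ

  positive⇒injective : ∀ {d n} {A : Hypermatrix d n} → StronglyOffDiagonal A →
                       ∀ {i} → 0# < A i → Injective _≡_ _≡_ i
  positive⇒injective offDiagonal {i} 0<Aᵢ {k} {l} iₖ≡iₗ with k Fin.≟ l
  ... | yes k≡l = k≡l
  ... | no k≢l  = ⊥-elim (pos⇒≢0 0<Aᵢ (offDiagonal i k l k≢l iₖ≡iₗ))

  extreme⇒distinctImages≤n : ∀ {d n r} {A : Hypermatrix d n} → IsExtremePoint (InN₀ d n r) A →
                             (ts : List (Index d n)) → All (λ i → 0# < A i) ts →
                             length (distinctImages ts) ℕ.≤ n
  extreme⇒distinctImages≤n {A = A} extreme@(A∈N₀ , _) ts positive = ℕ.≮⇒≥ λ n<m →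
    manyClasses-not-extreme A∈N₀ _≟ₛ_ image image-permute (List.lookup (distinctImages ts))
      (lookup-injective (distinctImages-unique ts)) n<m witness extreme
    where
    witness : ∀ k → ∃ λ i → image i ≡ List.lookup (distinctImages ts) k × 0# < A i
    witness k with t , t∈ts , image-t≡S ← ∈-distinctImages⁻ ts (∈-lookup k) =
      t , image-t≡S , All.lookup positive t∈ts

open import Data.Nat using (ℕ; _≤_; _*_; _!)
open import Data.Fin using (Fin)
open import Data.Product using (∃; _×_; _,_)
import Data.Nat.Properties as ℕ
import Data.List.Relation.Unary.All as All
open Counting using (length≤distinctImages*!)

proposition4p3 :
    (ℝ : RealField) → let open Hypermatrices ℝ in
    (d n : ℕ) → 2 ≤ d → d ≤ n →
    (r : Fin n → RealField.Carrier ℝ) →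
    (∀ i j → i Data.Fin.≤ j → RealField._≤_ ℝ (r j) (r i)) →
    (∀ i → RealField._≤_ ℝ (RealField.0# ℝ) (r i)) →
    (∃ λ A → InN₀ d n r A) →
    IsPolytope (InN₀ d n r) →
    (A : Hypermatrix d n) →
    IsExtremePoint (InN₀ d n r) A →
    AtMostPositiveEntries (n * (d !)) A
proposition4p3 ℝ d _ _ _ _ _ _ _ _ _ extreme@((offDiagonal , _) , _) ts apart positive =
  ℕ.≤-trans (length≤distinctImages*! ts apart (All.map (positive⇒injective offDiagonal) positive))
            (ℕ.*-monoˡ-≤ (d !) (extreme⇒distinctImages≤n extreme ts positive))
  where open ExtremePoints ℝ
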